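{- Let $\mathcal{H}=\bigcup_{i\in[t]}\bigcup_{j\in[\ell_i]}P_{i,j}$ be a coarse ear-decomposition in a graph $G$ of girth at least $5$ such that $t\ge2$ and $\ell_t\ge2$. Then $G-E(\mathcal{H})$ has no edge $ab$ with $a\in V(H_{t-1,\ell_{t-1}})$ and $b\in V(P_{t,1})\setminus\Gamma_{t,1}$, where $\Gamma_{t,1}=\{c_t\}$ if $P_{t,1}$ is of type 1 and $\Gamma_{t,1}=\emptyset$ if $P_{t,1}$ is of type 2.
   Context: Graphs are finite and simple; $[i]=\{1,\dots,i\}$. For $S\subseteq V(G)$ and $r\ge0$, $B_G(S,r)$ is the set of vertices at distance at most $r$ from $S$ in $G$. $V_{\ge3}(G)$ is the set of vertices of degree at least $3$ in $G$. For a subgraph $H$ of $G$, an $H$-path is a path in $G$ of length at least $1$ whose ends lie in $V(H)$, whose internal vertices are not in $V(H)$, and which shares no edge with $H$. Coarse ear-decomposition: for positive integers $t,\ell_1,\dots,\ell_t$, a subgraph $\mathcal{H}=\bigcup_{i\in[t]}\bigcup_{j\in[\ell_i]}P_{i,j}$ of $G$ such that, with $H_{0,0}$ the null graph, $\ell_0=0$, $Y_{0,0}=Z_{0,0}=\emptyset$, and for $i\in[t],j\in[\ell_i]$: $H_{i,j}=\bigl(\bigcup_{p\in[i-1]}\bigcup_{q\in[\ell_p]}P_{p,q}\bigr)\cup\bigcup_{r\in[j]}P_{i,r}$, $Y_{i,j}=B_{H_{i,j}}(V_{\ge3}(H_{i,j}),2)$, $Z_{i,j}=B_{G-(V(H_{i,j})\setminus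 Y_{i,j})}(Y_{i,j},1)$, the following hold. (A) For each $i\in[t]$, $G-Z_{i-1,\ell_{i-1}}$ has no $H_{i-1,\ell_{i-1}}$-path. (B) For each $i\in[t]$: if $G-Z_{i-1,\ell_{i-1}}$ has a cycle meeting $V(H_{i-1,\ell_{i-1}})$ in exactly one vertex, then $P_{i,1}$ is a shortest such cycle (type 1), and $c_i$ denotes that vertex; otherwise $P_{i,1}$ is a shortest cycle of $G-Z_{i-1,\ell_{i-1}}$ (type 2). (C) For each $i\in[t]$ and $j\in[\ell_i]\setminus\{1\}$, $P_{i,j}$ is a shortest $H_{i,j-1}$-path of $G-Z_{i,j-1}$. -}

module Defs where

open import Data.Nat using (ℕ; zero; suc; _≤_; _<_; _∸_)
open import Data.Fin using (Fin)
open import Data.List using (List; []; _∷_; _++_; length)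
open import Data.List.Membership.Propositional using (_∈_)
open import Data.List.Relation.Unary.All using (All)
open import Data.List.Relation.Unary.Unique.Propositional using (Unique)
open import Data.Product using (Σ; ∃; _×_; _,_)
open import Data.Sum using (_⊎_)
open import Data.Empty using (⊥)
open import Relation.Nullary using (¬_)
open import Relation.Binary.PropositionalEquality using (_≡_)

record Graph (n : ℕ) : Set₁ where
  field
    Adj    : Fin n → Fin n → Set
    sym    : ∀ {u v} → Adj u v → Adj v u
    irrefl : ∀ {u} → ¬ Adj u u

data Consec {n : ℕ} : List (Fin n) → Fin n → Fin n → Set where
  here  : ∀ {u v xs} → Consec (u ∷ v ∷ xs) u v
  there : ∀ {x u v xs} → Consec xs u v → Consec (x ∷ xs) u v

ListEdge : ∀ {n} → List (Fin n) → Fin n → Fin n → Set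
ListEdge xs u v = Consec xs u v ⊎ Consec xs v u

IsWalk : ∀ {n} → Graph n → List (Fin n) → Set
IsWalk G xs = ∀ {u v} → Consec xs u v → Graph.Adj G u v

IsPathIn : ∀ {n} → Graph n → (Fin n → Set) → List (Fin n) → Set
IsPathIn G Z xs = Unique xs × (2 ≤ length xs) × IsWalk G xs × All (λ v → ¬ Z v) xs

-- Cycles are represented by closed vertex lists  v ∷ ys ++ [v]
-- with v ∷ ys repetition-free and of length ≥ 3; the cycle's edges are the
-- consecutive pairs and its length (number of edges) is  length xs ∸ 1.
IsCycleIn : ∀ {n} → Graph n → (Fin n → Set) → List (Fin n) → Set
IsCycleIn G Z xs =
  Σ _ λ v → Σ _ λ ys →
    (xs ≡ v ∷ ys ++ v ∷ []) × Unique (v ∷ ys) × (2 ≤ length ys)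
    × IsWalk G xs × All (λ w → ¬ Z w) xs

cycLen : ∀ {n} → List (Fin n) → ℕ
cycLen xs = length xs ∸ 1

NoZ : ∀ {n} → Fin n → Set
NoZ _ = ⊥

Girth≥5 : ∀ {n} → Graph n → Set
Girth≥5 G = ∀ xs → IsCycleIn G NoZ xs → 5 ≤ cycLen xs

record Sub (n : ℕ) : Set₁ where
  field
    V : Fin n → Set
    E : Fin n → Fin n → Set

Deg≥3 : ∀ {n} → Sub n → Fin n → Set
Deg≥3 H s = Σ _ λ x → Σ _ λ y → Σ _ λ z →
  ¬ x ≡ y × ¬ x ≡ z × ¬ y ≡ z × Sub.E H s x × Sub.E H s y × Sub.E H s z

Ball2 : ∀ {n} → Sub n → (Fin n → Set) → Fin n → Set
Ball2 H S v = Σ _ λ s → S s ×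
  (v ≡ s ⊎ Sub.E H s v ⊎ Σ _ λ w → Sub.E H s w × Sub.E H w v)

IsHPath : ∀ {n} → Graph n → (Fin n → Set) → Sub n → List (Fin n) → Set
IsHPath G Z H xs =
  IsPathIn G Z xs
  × (Σ _ λ u → Σ _ λ mid → Σ _ λ w →
       (xs ≡ u ∷ mid ++ w ∷ []) × Sub.V H u × Sub.V H w
       × All (λ x → ¬ Sub.V H x) mid)
  × (∀ {u v} → Consec xs u v → ¬ Sub.E H u v)

OneMeetCycle : ∀ {n} → Graph n → (Fin n → Set) → Sub n → Fin n → List (Fin n) → Set
OneMeetCycle G Z H c xs =
  IsCycleIn G Z xs × c ∈ xs × Sub.V H c × (∀ v → v ∈ xs → Sub.V H v → v ≡ c)

-- Everything about a candidate coarse ear-decomposition with ear data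
-- t, ℓ, P (P i j meaningful for i ∈ [t], j ∈ [ℓ i]; ears P i 1 are
-- closed vertex lists as above, the others are paths).
module Ear {n : ℕ} (G : Graph n) (ℓ : ℕ → ℕ) (P : ℕ → ℕ → List (Fin n)) where

  open Graph G

  InRange : ℕ → ℕ → ℕ → ℕ → Set
  InRange p q i j = 1 ≤ p × 1 ≤ q × ((p < i × q ≤ ℓ p) ⊎ (p ≡ i × q ≤ j))

  H : ℕ → ℕ → Sub n
  H i j = record
    { V = λ v → Σ ℕ λ p → Σ ℕ λ q → InRange p q i j × v ∈ P p q
    ; E = λ u v → Σ ℕ λ p → Σ ℕ λ q → InRange p q i j × ListEdge (P p q) u v }

  Y : ℕ → ℕ → Fin n → Set
  Y i j = Ball2 (H i j) (Deg≥3 (H i j))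

  -- Z_{i,j} = B_{G - (V(H_{i,j}) \ Y_{i,j})}(Y_{i,j}, 1)
  Z : ℕ → ℕ → Fin n → Set
  Z i j v = Y i j v
    ⊎ (¬ (Sub.V (H i j) v × ¬ Y i j v) × Σ _ λ y → Y i j y × Adj v y)

  -- H_{i-1,ℓ_{i-1}} and Z_{i-1,ℓ_{i-1}}  (for i = 1 this H is the null graph)
  Hprev : ℕ → Sub n
  Hprev i = H (i ∸ 1) (ℓ (i ∸ 1))

  Zprev : ℕ → Fin n → Set
  Zprev i = Z (i ∸ 1) (ℓ (i ∸ 1))

  TypeOne : ℕ → Set
  TypeOne i = Σ _ λ c → Σ _ λ xs → OneMeetCycle G (Zprev i) (Hprev i) c xs

  CondA : ℕ → Set
  CondA i = ∀ xs → ¬ IsHPath G (Zprev i) (Hprev i) xs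

  CondB : ℕ → Set
  CondB i =
    (TypeOne i →
       Σ _ λ c → OneMeetCycle G (Zprev i) (Hprev i) c (P i 1)
         × (∀ c' xs → OneMeetCycle G (Zprev i) (Hprev i) c' xs
              → cycLen (P i 1) ≤ cycLen xs))
    × (¬ TypeOne i →
       IsCycleIn G (Zprev i) (P i 1)
         × (∀ xs → IsCycleIn G (Zprev i) xs → cycLen (P i 1) ≤ cycLen xs))

  CondC : ℕ → ℕ → Set
  CondC i j =
    IsHPath G (Z i (j ∸ 1)) (H i (j ∸ 1)) (P i j)
    × (∀ xs → IsHPath G (Z i (j ∸ 1)) (H i (j ∸ 1)) xs
         → length (P i j) ≤ length xs)

  IsCoarseEarDecomposition : ℕ → Set
  IsCoarseEarDecomposition t =
    (∀ i → 1 ≤ i → i ≤ t → 1 ≤ ℓ i)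
    × (∀ i → 1 ≤ i → i ≤ t → CondA i)
    × (∀ i → 1 ≤ i → i ≤ t → CondB i)
    × (∀ i j → 1 ≤ i → i ≤ t → 2 ≤ j → j ≤ ℓ i → CondC i j)

  -- Γ_{i,1}: b ∈ Γ_{i,1} iff P_{i,1} is of type 1 and b = c_i, the vertex
  -- in which P_{i,1} meets V(H_{i-1,ℓ_{i-1}}).
  InΓ : ℕ → Fin n → Set
  InΓ i b = TypeOne i × OneMeetCycle G (Zprev i) (Hprev i) b (P i 1)

{-# OPTIONS --safe #-}
module Submission where

-- Write Hₚ = H_{t-1,ℓ_{t-1}}, C = P_{t,1} and Zₚ = Z_{t-1,ℓ_{t-1}}, and let ab be an edge as in the
-- statement.  Condition (A) says that G - Zₚ has no Hₚ-path.
--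
-- If C is of type 1 with root c, then b ∉ V(Hₚ) (else b = c ∈ Γ).  For a = c the edge cb is a chord
-- of C cutting off a shorter cycle through c meeting Hₚ only in c; for a ≠ c the edge ab followed by
-- the arc of C from b to c is an Hₚ-path.
--
-- If C is of type 2, then C ⊆ V(Hₚ) or C ∩ V(Hₚ) = ∅: an arc of C leaving V(Hₚ) and returning to it
-- would be an Hₚ-path, or a cycle meeting Hₚ in one vertex.  If C ⊆ V(Hₚ), then H_{t,1} has the same
-- vertices as Hₚ and the H_{t,1}-path P_{t,2} is an Hₚ-path of G - Zₚ.  If C ∩ V(Hₚ) = ∅, the
-- vertices of degree ≥ 3 in H_{t,1} lie in Hₚ, so neither a nor C meets Z_{t,1} and ab itself is an
-- H_{t,1}-path of G - Z_{t,1}.  Hence the shortest such path P_{t,2} is a single edge xy ≠ ab, which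
-- is an Hₚ-path, a chord of the shortest cycle C, or, together with ab and an arc of C, closes an
-- Hₚ-path or a cycle meeting Hₚ once.

open import Defs
open import Data.Empty using (⊥; ⊥-elim)
open import Data.Fin as Fin using (Fin; _≟_)
open import Data.List using (List; []; _∷_; _++_; [_]; length; initLast; _∷ʳ′_)
open import Data.List.Properties using (++-assoc; length-++)
open import Data.List.Membership.Propositional using (_∈_; _∉_)
open import Data.List.Membership.Propositional.Properties using (∈-++⁺ˡ; ∈-++⁺ʳ; ∈-++⁻; ∈-∃++)
open import Data.List.Relation.Binary.Permutation.Propositional.Properties as ↭ using (∈-resp-↭; ↭-length)
open import Data.List.Relation.Unary.All as All using (All; []; _∷_)
import Data.List.Relation.Unary.All.Properties as All
open import Data.List.Relation.Unary.Any as Any using (Any; here; there)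
open import Data.List.Relation.Unary.First as First using (first)
open import Data.List.Relation.Unary.First.Properties using (toView)
open import Data.List.Relation.Unary.Unique.Propositional using (Unique; []; _∷_)
open import Data.List.Relation.Unary.Unique.Propositional.Properties using (++⁺; Unique[x∷xs]⇒x∉xs)
open import Data.Nat using (ℕ; zero; suc; _≤_; _<_; z≤n; s≤s)
open import Data.Nat.Properties
  using ( ≤-refl; ≤-trans; ≤-antisym; +-comm; suc-injective; <⇒≱; m<n⇒m<1+n; m<1+n⇒m<n∨m≡n
        ; module ≤-Reasoning)
open import Data.Product as Product using (Σ; ∃; ∃₂; _×_; _,_; proj₁; proj₂)
open import Data.Sum as Sum using (_⊎_; inj₁; inj₂; [_,_]′)
open import Function using (id; _∘_; _⇔_; mk⇔; Equivalence)
open import Relation.Binary.PropositionalEquality using (_≡_; _≢_; refl; sym; trans; cong; subst; subst₂)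
open import Relation.Nullary using (¬_; yes; no)
open import Relation.Nullary.Decidable using (¬¬-excluded-middle; toSum)
open import Relation.Unary using (Decidable)

-- Lists and cyclic lists

private variable
  A : Set
  a b x y z : A
  xs ys : List A

Unique-++⁻ˡ : ∀ xs → Unique (xs ++ ys) → Unique xs
Unique-++⁻ˡ []       _        = []
Unique-++⁻ˡ (x ∷ xs) (x∉ ∷ u) = All.++⁻ˡ xs x∉ ∷ Unique-++⁻ˡ xs u

Unique-++⁻ʳ : ∀ xs → Unique (xs ++ ys) → Unique ys
Unique-++⁻ʳ []       u       = u
Unique-++⁻ʳ (x ∷ xs) (_ ∷ u) = Unique-++⁻ʳ xs u

Unique-++⇒disjoint : ∀ xs → Unique (xs ++ ys) → y ∈ xs → y ∉ ys
Unique-++⇒disjoint (x ∷ xs) (x∉ ∷ u) (here refl) y∈ys = All.lookup (All.++⁻ʳ xs x∉) y∈ys refl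
Unique-++⇒disjoint (x ∷ xs) (_ ∷ u)  (there y∈xs) = Unique-++⇒disjoint xs u y∈xs

Unique-++-comm : ∀ xs → Unique (xs ++ ys) → Unique (ys ++ xs)
Unique-++-comm xs u =
  ++⁺ (Unique-++⁻ʳ xs u) (Unique-++⁻ˡ xs u) (λ (y∈ys , y∈xs) → Unique-++⇒disjoint xs u y∈xs y∈ys)

Unique-prefix : ∀ xs → Unique (xs ++ y ∷ ys) → Unique (xs ++ [ y ])
Unique-prefix {y = y} {ys = ys} xs u =
  Unique-++⁻ˡ (xs ++ [ y ]) (subst Unique (sym (++-assoc xs [ y ] ys)) u)

three-in-two : (x ≡ a ⊎ x ≡ b) → (y ≡ a ⊎ y ≡ b) → (z ≡ a ⊎ z ≡ b) → x ≡ y ⊎ x ≡ z ⊎ y ≡ z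
three-in-two (inj₁ refl) (inj₁ refl) _           = inj₁ refl
three-in-two (inj₂ refl) (inj₂ refl) _           = inj₁ refl
three-in-two (inj₁ refl) (inj₂ refl) (inj₁ refl) = inj₂ (inj₁ refl)
three-in-two (inj₁ refl) (inj₂ refl) (inj₂ refl) = inj₂ (inj₂ refl)
three-in-two (inj₂ refl) (inj₁ refl) (inj₁ refl) = inj₂ (inj₂ refl)
three-in-two (inj₂ refl) (inj₁ refl) (inj₂ refl) = inj₂ (inj₁ refl)

¬¬-decidable : ∀ {n} (V : Fin n → Set) → ¬ ¬ Decidable V
¬¬-decidable {zero}  V k = k (λ ())
¬¬-decidable {suc n} V k =
  ¬¬-excluded-middle λ V0? → ¬¬-decidable (V ∘ Fin.suc) λ V? → k λ { Fin.zero → V0? ; (Fin.suc i) → V? i }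

loop : A → List A → List A
loop v ys = v ∷ ys ++ [ v ]

module _ {v : A} where

  ∈-loop⁺ : x ∈ v ∷ ys → x ∈ loop v ys
  ∈-loop⁺ = ∈-++⁺ˡ

  ∈-loop⁻ : x ∈ loop v ys → x ∈ v ∷ ys
  ∈-loop⁻ x∈ with ∈-++⁻ (v ∷ _) x∈
  ... | inj₁ x∈′        = x∈′
  ... | inj₂ (here refl) = here refl

cycLen-loop : {n : ℕ} (v : Fin n) (ys : List (Fin n)) → cycLen (loop v ys) ≡ suc (length ys)
cycLen-loop v ys = trans (length-++ ys) (+-comm (length ys) 1)

module _ {n : ℕ} where

  private variable
    u v w w′ s : Fin n
    L M P Q : List (Fin n)

  consec⇒∈ˡ : Consec L u v → u ∈ L
  consec⇒∈ˡ here      = here refl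
  consec⇒∈ˡ (there c) = there (consec⇒∈ˡ c)

  consec⇒∈ʳ : Consec L u v → v ∈ L
  consec⇒∈ʳ here      = there (here refl)
  consec⇒∈ʳ (there c) = there (consec⇒∈ʳ c)

  consec-∷⇒∈ʳ : Consec (w ∷ L) u v → v ∈ L
  consec-∷⇒∈ʳ here      = here refl
  consec-∷⇒∈ʳ (there c) = consec⇒∈ʳ c

  consec-∷ʳ⇒∈ˡ : ∀ L → Consec (L ++ [ w ]) u v → u ∈ L
  consec-∷ʳ⇒∈ˡ []           (there ())
  consec-∷ʳ⇒∈ˡ (x ∷ [])     here      = here refl
  consec-∷ʳ⇒∈ˡ (x ∷ y ∷ L)  here      = here refl
  consec-∷ʳ⇒∈ˡ (x ∷ L)      (there c) = there (consec-∷ʳ⇒∈ˡ L c)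

  ListEdge⇒∈ˡ : ListEdge L u v → u ∈ L
  ListEdge⇒∈ˡ = [ consec⇒∈ˡ , consec⇒∈ʳ ]′

  ListEdge⇒∈ʳ : ListEdge L u v → v ∈ L
  ListEdge⇒∈ʳ = [ consec⇒∈ʳ , consec⇒∈ˡ ]′

  consec-++⁺ˡ : Consec L x y → Consec (L ++ M) x y
  consec-++⁺ˡ here      = here
  consec-++⁺ˡ (there c) = there (consec-++⁺ˡ c)

  consec-++⁺ʳ : ∀ L → Consec M u v → Consec (L ++ M) u v
  consec-++⁺ʳ []      c = c
  consec-++⁺ʳ (x ∷ L) c = there (consec-++⁺ʳ L c)

  consec-glue⁻ : ∀ L → Consec (L ++ w ∷ M) u v → Consec (L ++ [ w ]) u v ⊎ Consec (w ∷ M) u v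
  consec-glue⁻ []          c         = inj₂ c
  consec-glue⁻ (x ∷ [])    here      = inj₁ here
  consec-glue⁻ (x ∷ y ∷ L) here      = inj₁ here
  consec-glue⁻ (x ∷ L)     (there c) = Sum.map₁ there (consec-glue⁻ L c)

  consec-glue⁺ : ∀ L → Consec (L ++ [ w ]) u v ⊎ Consec (w ∷ M) u v → Consec (L ++ w ∷ M) u v
  consec-glue⁺ L           (inj₂ c)         = consec-++⁺ʳ L c
  consec-glue⁺ []          (inj₁ (there ()))
  consec-glue⁺ (x ∷ [])    (inj₁ here)      = here
  consec-glue⁺ (x ∷ y ∷ L) (inj₁ here)      = here
  consec-glue⁺ (x ∷ L)     (inj₁ (there c)) = there (consec-glue⁺ L (inj₁ c))

  consec-subst : L ≡ M → Consec L x y → Consec M x y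
  consec-subst refl c = c

  loop-split : ∀ P → loop v (P ++ w ∷ Q) ≡ (v ∷ P) ++ w ∷ (Q ++ [ v ])
  loop-split {v = v} {w} {Q} P = cong (v ∷_) (++-assoc P (w ∷ Q) [ v ])

  consec-loop⁻ : ∀ P → Consec (loop v (P ++ w ∷ Q)) x y →
                 Consec (v ∷ P ++ [ w ]) x y ⊎ Consec (w ∷ Q ++ [ v ]) x y
  consec-loop⁻ P c = consec-glue⁻ (_ ∷ P) (consec-subst (loop-split P) c)

  consec-loop⁺ : ∀ P → Consec (v ∷ P ++ [ w ]) x y ⊎ Consec (w ∷ Q ++ [ v ]) x y →
                 Consec (loop v (P ++ w ∷ Q)) x y
  consec-loop⁺ P c = consec-subst (sym (loop-split P)) (consec-glue⁺ (_ ∷ P) c)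

  consec-rotate : ∀ P → Consec (loop v (P ++ w ∷ Q)) x y → Consec (loop w (Q ++ v ∷ P)) x y
  consec-rotate {Q = Q} P = consec-loop⁺ Q ∘ Sum.swap ∘ consec-loop⁻ P

  record Rotation (C : List (Fin n)) (s : Fin n) : Set where
    constructor mkRotation
    field
      body    : List (Fin n)
      unique  : Unique (s ∷ body)
      long    : 2 ≤ length body
      members : ∀ {x} → x ∈ C ⇔ x ∈ loop s body
      edges   : ∀ {x y} → Consec C x y ⇔ Consec (loop s body) x y
      cycLen≡ : cycLen (loop s body) ≡ cycLen C

  rotate : ∀ {G Z C} → IsCycleIn G Z C → s ∈ C → Rotation C s
  rotate (v , ys , refl , uniq , long , _) s∈C with ∈-loop⁻ s∈C
  ... | here refl = record
    { body = ys ; unique = uniq ; long = long ; members = mk⇔ id id ; edges = mk⇔ id id ; cycLen≡ = refl }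
  ... | there s∈ys with ∈-∃++ s∈ys
  ...   | P , Q , refl = record
    { body    = Q ++ v ∷ P
    ; unique  = Unique-++-comm (v ∷ P) uniq
    ; long    = subst (2 ≤_) length≡ long
    ; members = mk⇔ (∈-loop⁺ ∘ ∈-resp-↭ (↭.++-comm (v ∷ P) (_ ∷ Q)) ∘ ∈-loop⁻)
                    (∈-loop⁺ ∘ ∈-resp-↭ (↭.++-comm (_ ∷ Q) (v ∷ P)) ∘ ∈-loop⁻)
    ; edges   = mk⇔ (consec-rotate P) (consec-rotate Q)
    ; cycLen≡ = trans (cycLen-loop _ (Q ++ v ∷ P)) (trans (cong suc (sym length≡)) (sym (cycLen-loop v ys)))
    }
    where
    length≡ : length (P ++ _ ∷ Q) ≡ length (Q ++ v ∷ P)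
    length≡ = suc-injective (↭-length (↭.++-comm (v ∷ P) (_ ∷ Q)))

  record Segment (C L : List (Fin n)) : Set where
    field
      unique  : Unique L
      members : ∀ {x} → x ∈ L → x ∈ C
      edges   : ∀ {x y} → Consec L x y → Consec C x y

  ∈-extend : ∀ L → x ∈ L ++ [ y ] → x ∈ L ++ y ∷ M
  ∈-extend L x∈ with ∈-++⁻ L x∈
  ... | inj₁ x∈L         = ∈-++⁺ˡ x∈L
  ... | inj₂ (here refl) = ∈-++⁺ʳ L (here refl)

  segment : {C : List (Fin n)} (R : Rotation C s) → Rotation.body R ≡ P ++ y ∷ Q → Segment C (s ∷ P ++ [ y ])
  segment {s = s} {P = P} R eq = record
    { unique  = Unique-prefix (s ∷ P) (subst (λ B → Unique (s ∷ B)) eq unique)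
    ; members = from members ∘ ∈-loop⁺ ∘ subst (λ B → _ ∈ s ∷ B) (sym eq) ∘ ∈-extend (s ∷ P)
    ; edges   = from edges ∘ consec-subst (cong (loop s) (sym eq)) ∘ consec-loop⁺ P ∘ inj₁
    }
    where open Rotation R
          open Equivalence

  successor-of-root : s ∉ w ∷ L → Consec (loop s (w ∷ L)) s x → x ≡ w
  successor-of-root s∉ here      = refl
  successor-of-root s∉ (there c) = ⊥-elim (s∉ (consec-∷ʳ⇒∈ˡ (_ ∷ _) c))

  predecessor-of-root : s ∉ L ++ [ w ] → Consec (loop s (L ++ [ w ])) x s → x ≡ w
  predecessor-of-root {L = L} s∉ c with consec-loop⁻ {Q = []} L c
  ... | inj₁ c′   = ⊥-elim (s∉ (consec-∷⇒∈ʳ c′))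
  ... | inj₂ here = refl
  ... | inj₂ (there (there ()))

  loop-degree≤2 : Unique (s ∷ L) → 2 ≤ length L →
                  ListEdge (loop s L) s x → ListEdge (loop s L) s y → ListEdge (loop s L) s z →
                  x ≡ y ⊎ x ≡ z ⊎ y ≡ z
  loop-degree≤2 {L = w ∷ L′} uniq long ex ey ez with initLast L′ | long
  ... | []       | s≤s ()
  ... | M ∷ʳ′ w′ | _ = three-in-two (neighbour ex) (neighbour ey) (neighbour ez)
    where
    s∉ = Unique[x∷xs]⇒x∉xs uniq
    neighbour : ListEdge (loop _ (w ∷ M ++ [ w′ ])) _ x → x ≡ w ⊎ x ≡ w′
    neighbour (inj₁ c) = inj₁ (successor-of-root s∉ c)
    neighbour (inj₂ c) = inj₂ (predecessor-of-root {L = w ∷ M} s∉ c)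

  boundary-edge : {V : Fin n → Set} → Decidable V → V w → Any (¬_ ∘ V) L →
             ∃₂ λ u v → Consec (w ∷ L) u v × V u × ¬ V v
  boundary-edge V? Vw (here ¬Vv) = _ , _ , here , Vw , ¬Vv
  boundary-edge {L = v ∷ L} V? Vw (there out) with V? v
  ... | yes Vv = Product.map₂ (Product.map₂ (Product.map₁ there)) (boundary-edge V? Vv out)
  ... | no ¬Vv = _ , _ , here , Vw , ¬Vv

  consec-touches : ∀ S → Consec (w ∷ (v ∷ S) ++ [ w′ ]) x y → x ∈ v ∷ S ⊎ y ∈ v ∷ S
  consec-touches S here      = inj₂ (here refl)
  consec-touches S (there c) = inj₁ (consec-∷ʳ⇒∈ˡ (_ ∷ S) c)

  length-prefix< : ∀ L → length (L ++ [ x ]) < length (L ++ x ∷ y ∷ M)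
  length-prefix< []      = s≤s (s≤s z≤n)
  length-prefix< (_ ∷ L) = s≤s (length-prefix< L)

  2≤length-∷-∷ʳ : ∀ S → 2 ≤ length (w ∷ S ++ [ w′ ])
  2≤length-∷-∷ʳ []      = s≤s (s≤s z≤n)
  2≤length-∷-∷ʳ (_ ∷ _) = s≤s (s≤s z≤n)

-- Paths and cycles in a graph

record _⊑_ {n : ℕ} (H H′ : Sub n) : Set where
  field
    V⊆ : ∀ {v} → Sub.V H v → Sub.V H′ v
    E⊆ : ∀ {u v} → Sub.E H u v → Sub.E H′ u v

module Paths {n : ℕ} (G : Graph n) where

  open Graph G renaming (sym to Adj-sym)

  private variable
    u v w : Fin n
    L : List (Fin n)

  walk-∷ : Adj u v → IsWalk G (v ∷ L) → IsWalk G (u ∷ v ∷ L)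
  walk-∷ uv _  here      = uv
  walk-∷ _  vL (there c) = vL c

  walk-∷ʳ : ∀ L → IsWalk G (L ++ [ v ]) → Adj v w → IsWalk G ((L ++ [ v ]) ++ [ w ])
  walk-∷ʳ L walk vw c with consec-glue⁻ L (consec-subst (++-assoc L _ _) c)
  ... | inj₁ c′   = walk c′
  ... | inj₂ here = vw
  ... | inj₂ (there (there ()))

  record Detour (Z : Fin n → Set) (H : Sub n) (a : Fin n) (S : List (Fin n)) (e : Fin n) : Set where
    field
      start   : Sub.V H a
      end     : Sub.V H e
      unique  : Unique S
      outside : All (λ x → ¬ Sub.V H x) S
      walk    : IsWalk G (a ∷ S ++ [ e ])
      avoids  : All (λ x → ¬ Z x) (a ∷ S ++ [ e ])

  module _ {Z : Fin n → Set} {H : Sub n} {a e : Fin n} {S : List (Fin n)} (D : Detour Z H a S e) where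

    open Detour D

    private
      a∉S : All (a ≢_) S
      a∉S = All.map (λ ¬Vx a≡x → ¬Vx (subst (Sub.V H) a≡x start)) outside

    detour-isHPath : a ≢ e → (∀ {x y} → Consec (a ∷ S ++ [ e ]) x y → ¬ Sub.E H x y) →
                     IsHPath G Z H (a ∷ S ++ [ e ])
    detour-isHPath a≢e notInH =
      ( ( All.++⁺ a∉S (a≢e ∷ [])
          ∷ ++⁺ unique ([] ∷ []) (λ { (e∈S , here refl) → All.lookup outside e∈S end })
        , 2≤length-∷-∷ʳ {w = a} {w′ = e} S , walk , avoids )
      , (a , S , e , refl , start , end , outside)
      , notInH )

    detour-isOneMeetCycle : a ≡ e → 2 ≤ length S → OneMeetCycle G Z H a (loop a S)
    detour-isOneMeetCycle refl long =
      (a , S , refl , a∉S ∷ unique , long , walk , avoids) , here refl , start , meetsOnlyAt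
      where
      meetsOnlyAt : ∀ v → v ∈ loop a S → Sub.V H v → v ≡ a
      meetsOnlyAt v v∈ Vv with ∈-loop⁻ v∈
      ... | here v≡a  = v≡a
      ... | there v∈S = ⊥-elim (All.lookup outside v∈S Vv)

  detour-edges-outside : ∀ {Z H a v S e} → (∀ {x y} → Sub.E H x y → Sub.V H x × Sub.V H y) →
                         Detour Z H a (v ∷ S) e → ∀ {x y} → Consec (a ∷ (v ∷ S) ++ [ e ]) x y → ¬ Sub.E H x y
  detour-edges-outside E⊆V D c xy∈H with consec-touches _ c
  ... | inj₁ x∈S = All.lookup (Detour.outside D) x∈S (proj₁ (E⊆V xy∈H))
  ... | inj₂ y∈S = All.lookup (Detour.outside D) y∈S (proj₂ (E⊆V xy∈H))

  record IsHEdge (Z : Fin n → Set) (H : Sub n) (u v : Fin n) : Set where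
    field
      start    : Sub.V H u
      end      : Sub.V H v
      distinct : u ≢ v
      adjacent : Adj u v
      avoids   : ¬ Z u × ¬ Z v
      notInH   : ¬ Sub.E H u v

  IsHEdge⇒IsHPath : ∀ {Z H} → IsHEdge Z H u v → IsHPath G Z H (u ∷ [ v ])
  IsHEdge⇒IsHPath {Z = Z} {H} e = detour-isHPath D distinct notInH′
    where
    open IsHEdge e
    D : Detour Z H _ [] _
    D = record { start = start ; end = end ; unique = [] ; outside = []
               ; walk = walk-∷ adjacent (λ { (there ()) }) ; avoids = proj₁ avoids ∷ proj₂ avoids ∷ [] }
    notInH′ : ∀ {x y} → Consec (_ ∷ [ _ ]) x y → ¬ Sub.E H x y
    notInH′ here = notInH
    notInH′ (there (there ()))

  IsHPath⇒IsHEdge : ∀ {Z H} → IsHPath G Z H (u ∷ [ v ]) → IsHEdge Z H u v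
  IsHPath⇒IsHEdge ((u∉ ∷ _ , _ , walk , ¬Zu ∷ ¬Zv ∷ []) , (_ , [] , _ , refl , Vu , Vv , []) , notInH) = record
    { start = Vu ; end = Vv ; distinct = All.head u∉ ; adjacent = walk here ; avoids = ¬Zu , ¬Zv ; notInH = notInH here }
  IsHPath⇒IsHEdge (_ , (_ , _ ∷ [] , _ , () , _) , _)
  IsHPath⇒IsHEdge (_ , (_ , _ ∷ _ ∷ _ , _ , () , _) , _)

  IsHPath-restrict : ∀ {Z Z′ H H′ xs} → H ⊑ H′ → (∀ {v} → Z v → Z′ v) →
                     (∀ {v} → Sub.V H′ v → ¬ ¬ Sub.V H v) →
                     IsHPath G Z′ H′ xs → ¬ ¬ IsHPath G Z H xs
  IsHPath-restrict H⊑H′ Z⊆Z′ V′⇒V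
                   ((uniq , long , walk , avoids) , (a , mid , e , refl , Va , Ve , outside) , notInH) k =
    V′⇒V Va λ Va → V′⇒V Ve λ Ve →
      k ( (uniq , long , walk , All.map (_∘ Z⊆Z′) avoids)
        , (a , mid , e , refl , Va , Ve , All.map (_∘ V⊆) outside)
        , (λ c → notInH c ∘ E⊆) )
    where open _⊑_ H⊑H′

  shortest-HPath-is-edge : ∀ {Z H xs} → IsHPath G Z H xs → (∀ ys → IsHPath G Z H ys → length xs ≤ length ys) →
                           IsHPath G Z H (u ∷ [ v ]) → ∃₂ λ x y → xs ≡ x ∷ [ y ] × IsHEdge Z H x y
  shortest-HPath-is-edge path@(_ , (x , []    , y , refl , _) , _) _ _ = x , y , refl , IsHPath⇒IsHEdge path
  shortest-HPath-is-edge (_ , (x , m ∷ mid , y , refl , _) , _) shortest uv = ⊥-elim (too-long mid (shortest _ uv))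
    where
    too-long : ∀ mid → ¬ (length (x ∷ m ∷ mid ++ [ y ]) ≤ 2)
    too-long []      (s≤s (s≤s ()))
    too-long (_ ∷ _) (s≤s (s≤s ()))

  cycle-walk : ∀ {Z C} → IsCycleIn G Z C → IsWalk G C
  cycle-walk (_ , _ , _ , _ , _ , walk , _) = walk

  cycle-avoids : ∀ {Z C x} → IsCycleIn G Z C → x ∈ C → ¬ Z x
  cycle-avoids (_ , _ , _ , _ , _ , _ , avoids) = All.lookup avoids

  module OnCycle {Z : Fin n → Set} {C : List (Fin n)} (cycle : IsCycleIn G Z C) where

    open Equivalence

    rotation : u ∈ C → Rotation C u
    rotation = rotate {G = G} {Z = Z} cycle

    segment-walk : Segment C L → IsWalk G L
    segment-walk S = cycle-walk cycle ∘ Segment.edges S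

    segment-between : u ∈ C → v ∈ C → u ≢ v → ∃ λ P → Segment C (u ∷ P ++ [ v ])
    segment-between {u} {v} u∈C v∈C u≢v = split (∈-loop⁻ (to members v∈C))
      where
      R = rotation u∈C
      open Rotation R
      split : v ∈ u ∷ body → ∃ λ P → Segment C (u ∷ P ++ [ v ])
      split (here v≡u)    = ⊥-elim (u≢v (sym v≡u))
      split (there v∈body) with P , Q , eq ← ∈-∃++ v∈body = P , segment {P = P} R eq

    Shortcut : Fin n → Set
    Shortcut u = ∃ λ D → IsCycleIn G Z D × (∀ {x} → x ∈ D → x ∈ C) × u ∈ D × cycLen D < cycLen C

    chord-shortcut : u ∈ C → v ∈ C → u ≢ v → Adj u v → ¬ ListEdge C u v → Shortcut u
    chord-shortcut {u} {v} u∈C v∈C u≢v uv notEdge = split (∈-loop⁻ (to members u∈C))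
      where
      R = rotation v∈C
      open Rotation R
      split : u ∈ v ∷ body → Shortcut u
      split (here u≡v)    = ⊥-elim (u≢v u≡v)
      split (there u∈body) with ∈-∃++ u∈body
      ... | [] , Q , eq = ⊥-elim (notEdge (inj₂ (from edges (consec-subst (cong (loop v) (sym eq)) here))))
      ... | P , [] , eq = ⊥-elim (
        notEdge (inj₁ (from edges (consec-subst (cong (loop v) (sym eq)) (consec-loop⁺ P (inj₂ here))))))
      ... | p ∷ P , q ∷ Q , eq = loop v (p ∷ P ++ [ u ]) , isCycle , Segment.members S ∘ ∈-loop⁻
                                , ∈-loop⁺ (there (∈-++⁺ʳ (p ∷ P) (here refl))) , shorter
        where
        S = segment {P = p ∷ P} R eq
        isCycle : IsCycleIn G Z (loop v (p ∷ P ++ [ u ]))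
        isCycle = v , p ∷ P ++ [ u ] , refl , Segment.unique S , 2≤length-∷-∷ʳ {w = p} {w′ = u} P
                , walk-∷ʳ (v ∷ p ∷ P) (segment-walk S) uv
                , All.tabulate (cycle-avoids cycle ∘ Segment.members S ∘ ∈-loop⁻)
        open ≤-Reasoning
        shorter : cycLen (loop v (p ∷ P ++ [ u ])) < cycLen C
        shorter = begin-strict
          cycLen (loop v (p ∷ P ++ [ u ]))  ≡⟨ cycLen-loop v (p ∷ P ++ [ u ]) ⟩
          suc (length (p ∷ P ++ [ u ]))      <⟨ s≤s (length-prefix< (p ∷ P)) ⟩
          suc (length (p ∷ P ++ u ∷ q ∷ Q))  ≡⟨ cong (suc ∘ length) (sym eq) ⟩
          suc (length body)                  ≡⟨ sym (cycLen-loop v body) ⟩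
          cycLen (loop v body)               ≡⟨ cycLen≡ ⟩
          cycLen C                           ∎

    shortest-cycle-chordless : (∀ D → IsCycleIn G Z D → cycLen C ≤ cycLen D) →
                               u ∈ C → v ∈ C → u ≢ v → Adj u v → ¬ ¬ ListEdge C u v
    shortest-cycle-chordless shortest u∈C v∈C u≢v uv notEdge
      with D , isCycle , _ , _ , shorter ← chord-shortcut u∈C v∈C u≢v uv notEdge =
      <⇒≱ shorter (shortest D isCycle)

    shortest-one-meet-cycle-chordless : ∀ {H c} → (∀ c′ D → OneMeetCycle G Z H c′ D → cycLen C ≤ cycLen D) →
                                        OneMeetCycle G Z H c C → v ∈ C → c ≢ v → Adj c v → ¬ ¬ ListEdge C c v
    shortest-one-meet-cycle-chordless shortest (_ , c∈C , Vc , meetsOnlyAt) v∈C c≢v cv notEdge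
      with D , isCycle , D⊆C , c∈D , shorter ← chord-shortcut c∈C v∈C c≢v cv notEdge =
      <⇒≱ shorter (shortest _ D (isCycle , c∈D , Vc , λ x x∈D → meetsOnlyAt x (D⊆C x∈D)))

    cycle-degree≤2 : ListEdge C u x → ListEdge C u y → ListEdge C u z → x ≡ y ⊎ x ≡ z ⊎ y ≡ z
    cycle-degree≤2 ux uy uz = loop-degree≤2 unique long (toLoop ux) (toLoop uy) (toLoop uz)
      where
      open Rotation (rotation (ListEdge⇒∈ˡ ux))
      toLoop : ListEdge C _ x → ListEdge (loop _ body) _ x
      toLoop = Sum.map (to edges) (to edges)

  module WithoutHPaths {Z : Fin n → Set} {H : Sub n}
           (E⊆V : ∀ {x y} → Sub.E H x y → Sub.V H x × Sub.V H y)
           (noHPath : ∀ xs → ¬ IsHPath G Z H xs)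
           {C : List (Fin n)} (cycle : IsCycleIn G Z C) where

    open Sub H
    open OnCycle cycle
    open Equivalence

    private variable
      c e t : Fin n
      T : List (Fin n)

    avoids-segment : Segment C L → All (λ x → ¬ Z x) L
    avoids-segment S = All.tabulate (cycle-avoids cycle ∘ Segment.members S)

    one-meet-cycle-unattached : OneMeetCycle G Z H c C → V a → ¬ Z a → Adj a b → b ∈ C → a ≢ c → b ≢ c → ⊥
    one-meet-cycle-unattached {c} {a} {b} (_ , c∈C , Vc , meetsOnlyAt) Va ¬Za ab b∈C a≢c b≢c
      with P , S ← segment-between b∈C c∈C b≢c =
      noHPath _ (detour-isHPath D a≢c (detour-edges-outside E⊆V D))
      where
      open Segment S
      c∉ : c ∉ b ∷ P
      c∉ c∈ = Unique-++⇒disjoint (b ∷ P) unique c∈ (here refl)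
      D : Detour Z H a (b ∷ P) c
      D = record
        { start   = Va
        ; end     = Vc
        ; unique  = Unique-++⁻ˡ (b ∷ P) unique
        ; outside = All.tabulate λ x∈ Vx → c∉ (subst (_∈ b ∷ P) (meetsOnlyAt _ (members (∈-++⁺ˡ x∈)) Vx) x∈)
        ; walk    = walk-∷ ab (segment-walk S)
        ; avoids  = ¬Za ∷ avoids-segment S
        }

    module _ (noOneMeet : ∀ c xs → ¬ OneMeetCycle G Z H c xs) where

      no-detour : Detour Z H a (t ∷ T) e → (a ≡ e → 2 ≤ length (t ∷ T)) → ⊥
      no-detour {a} {e = e} D long with a ≟ e
      ... | yes a≡e = noOneMeet a _ (detour-isOneMeetCycle D a≡e (long a≡e))
      ... | no  a≢e = noHPath _ (detour-isHPath D a≢e (detour-edges-outside E⊆V D))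

      attachment-unique : (∀ {x} → x ∈ C → ¬ V x) → V a → ¬ Z a → Adj a b → b ∈ C →
                 V x → ¬ Z x → y ∈ C → Adj y x → ¬ (x ≡ a × y ≡ b) → ⊥
      attachment-unique {a} {b} {x} {y} disjoint Va ¬Za ab b∈C Vx ¬Zx y∈C yx notab with y ≟ b
      ... | yes refl = no-detour D (λ a≡x → ⊥-elim (notab (sym a≡x , refl)))
        where
        D : Detour Z H a [ y ] x
        D = record
          { start = Va ; end = Vx ; unique = [] ∷ [] ; outside = disjoint y∈C ∷ []
          ; walk = walk-∷ ab (walk-∷ yx λ { (there ()) })
          ; avoids = ¬Za ∷ cycle-avoids cycle y∈C ∷ ¬Zx ∷ [] }
      ... | no y≢b with P , S ← segment-between b∈C y∈C (y≢b ∘ sym) =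
        no-detour D (λ _ → 2≤length-∷-∷ʳ {w = b} {w′ = y} P)
        where
        D : Detour Z H a (b ∷ P ++ [ y ]) x
        D = record
          { start = Va ; end = Vx ; unique = Segment.unique S
          ; outside = All.tabulate (disjoint ∘ Segment.members S)
          ; walk = walk-∷ ab (walk-∷ʳ (b ∷ P) (segment-walk S) yx)
          ; avoids = ¬Za ∷ All.++⁺ (avoids-segment S) (¬Zx ∷ []) }

      private
        no-exit-edge : Decidable V → V a → ¬ V b → Rotation C a → Consec C a b → ⊥
        no-exit-edge V? Va ¬Vb R@(mkRotation (b′ ∷ rest) uniq long members edges _) ab
          with successor-of-root (Unique[x∷xs]⇒x∉xs uniq) (to edges ab)
        ... | refl with first (λ x → Sum.swap (toSum (V? x))) rest
        ... | inj₂ outside = no-detour D (λ _ → long)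
          where
          D : Detour Z H _ (b′ ∷ rest) _
          D = record
            { start = Va ; end = Va ; unique = Unique-++⁻ʳ [ _ ] uniq ; outside = ¬Vb ∷ outside
            ; walk = cycle-walk cycle ∘ from edges
            ; avoids = All.tabulate (cycle-avoids cycle ∘ from members) }
        ... | inj₁ firstBack with toView firstBack
        ... | First._++_∷_ {A} {w} outside Vw B =
          no-detour D (λ a≡w → ⊥-elim (a∉ (∈-++⁺ʳ (b′ ∷ A) (here a≡w))))
          where
          S = segment {P = b′ ∷ A} R refl
          a∉ : _ ∉ (b′ ∷ A) ++ [ w ]
          a∉ = Unique[x∷xs]⇒x∉xs (Segment.unique S)
          D : Detour Z H _ (b′ ∷ A) w
          D = record
            { start = Va ; end = Vw ; unique = Unique-++⁻ˡ (b′ ∷ A) (Unique-++⁻ʳ [ _ ] (Segment.unique S))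
            ; outside = ¬Vb ∷ outside
            ; walk = segment-walk S
            ; avoids = avoids-segment S }

      cycle-inside-or-disjoint : x ∈ C → V x → y ∈ C → ¬ V y → ⊥
      cycle-inside-or-disjoint {x} {y} x∈C Vx y∈C ¬Vy =
        ¬¬-decidable V λ V? → find-exit V? (∈-loop⁻ (to members y∈C))
        where
        open Rotation (rotation x∈C)
        find-exit : Decidable V → y ∈ x ∷ body → ⊥
        find-exit V? (here refl)    = ¬Vy Vx
        find-exit V? (there y∈body)
          with u , v , uv , Vu , ¬Vv ← boundary-edge V? Vx (Any.map (λ { refl → ¬Vy }) y∈body) =
          no-exit-edge V? Vu ¬Vv (rotation (consec⇒∈ˡ uv∈C)) uv∈C
          where
          uv∈C = from edges (consec-++⁺ˡ uv)

-- The sets Y and Z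

module Zones {n : ℕ} (G : Graph n) where

  open Graph G renaming (sym to Adj-sym)

  private variable
    v : Fin n

  -- Ear.Y G ℓ P i j and Ear.Z G ℓ P i j unfold to Y (Ear.H G ℓ P i j) and Z (Ear.H G ℓ P i j).
  Y : Sub n → Fin n → Set
  Y H = Ball2 H (Deg≥3 H)

  Z : Sub n → Fin n → Set
  Z H v = Y H v ⊎ (¬ (Sub.V H v × ¬ Y H v) × Σ _ λ y → Y H y × Adj v y)

  Deg≥3-mono : ∀ {H H′ : Sub n} {s} → (∀ {w} → Sub.E H s w → Sub.E H′ s w) → Deg≥3 H s → Deg≥3 H′ s
  Deg≥3-mono E⊆ (x , y , z , x≢y , x≢z , y≢z , sx , sy , sz) =
    x , y , z , x≢y , x≢z , y≢z , E⊆ sx , E⊆ sy , E⊆ sz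

  Y-mono : ∀ {H H′} → H ⊑ H′ → Y H v → Y H′ v
  Y-mono {H = H} {H′} H⊑H′ (s , branching , near) =
    s , Deg≥3-mono {H} {H′} E⊆ branching , Sum.map₂ (Sum.map E⊆ (Product.map₂ (Product.map E⊆ E⊆))) near
    where open _⊑_ H⊑H′

  Z-mono : ∀ {H H′} → H ⊑ H′ → (Sub.V H′ v → ¬ ¬ Sub.V H v) → Z H v → Z H′ v
  Z-mono H⊑H′ V′⇒V (inj₁ Yv) = inj₁ (Y-mono H⊑H′ Yv)
  Z-mono H⊑H′ V′⇒V (inj₂ (notKept , y , Yy , vy)) =
    inj₂ ((λ (V′v , ¬Y′v) → V′⇒V V′v λ Vv → notKept (Vv , ¬Y′v ∘ Y-mono H⊑H′)) , y , Y-mono H⊑H′ Yy , vy)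

  ¬Z-of-¬Y : ∀ {H} → Sub.V H v → ¬ Y H v → ¬ Z H v
  ¬Z-of-¬Y Vv ¬Yv (inj₁ Yv)             = ¬Yv Yv
  ¬Z-of-¬Y Vv ¬Yv (inj₂ (notKept , _)) = notKept (Vv , ¬Yv)

  ¬Z-of-neighbour : ∀ {H u v} → Sub.V H u → ¬ Sub.V H v → ¬ Z H v → Adj u v → ¬ Z H u
  ¬Z-of-neighbour {H} {u} {v} Vu ¬Vv ¬Zv uv = ¬Z-of-¬Y {H = H} Vu (¬Zv ∘ Z-of-Y-neighbour)
    where
    Z-of-Y-neighbour : Y H u → Z H v
    Z-of-Y-neighbour Yu = inj₂ (¬Vv ∘ proj₁ , u , Yu , Adj-sym uv)

  Y-restrict : ∀ {H H′ v} → (∀ {x y} → Sub.E H x y → Sub.V H x × Sub.V H y) →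
               (∀ {s w} → Sub.V H s → Sub.E H′ s w → Sub.E H s w) →
               (∀ {s} → Deg≥3 H′ s → Sub.V H s) →
               Y H′ v → Sub.V H v × Y H v
  Y-restrict {H} {H′} {v} E⊆V E′⇒E branching⇒V (s , branching , near) =
    Product.map₂ (λ near′ → s , Deg≥3-mono {H′} {H} (E′⇒E Vs) branching , near′) (restrict near)
    where
    Vs = branching⇒V branching
    restrict : v ≡ s ⊎ Sub.E H′ s v ⊎ Σ _ (λ w → Sub.E H′ s w × Sub.E H′ w v) →
               Sub.V H v × (v ≡ s ⊎ Sub.E H s v ⊎ Σ _ (λ w → Sub.E H s w × Sub.E H w v))
    restrict (inj₁ refl)         = Vs , inj₁ refl
    restrict (inj₂ (inj₁ sv))    = proj₂ (E⊆V (E′⇒E Vs sv)) , inj₂ (inj₁ (E′⇒E Vs sv))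
    restrict (inj₂ (inj₂ (w , sw , wv))) =
      let sw′ = E′⇒E Vs sw
          wv′ = E′⇒E (proj₂ (E⊆V sw′)) wv
      in  proj₂ (E⊆V wv′) , inj₂ (inj₂ (w , sw′ , wv′))

-- Indices of a coarse ear-decomposition

module EarIndexing {n : ℕ} (G : Graph n) (ℓ : ℕ → ℕ) (P : ℕ → ℕ → List (Fin n)) where

  open Ear G ℓ P using (InRange; H)

  private variable
    i i′ j j′ p q : ℕ
    u v : Fin n

  InRange-prev : InRange p q i (ℓ i) → InRange p q (suc i) j
  InRange-prev (1≤p , 1≤q , inj₁ (p<i , q≤ℓp)) = 1≤p , 1≤q , inj₁ (m<n⇒m<1+n p<i , q≤ℓp)
  InRange-prev (1≤p , 1≤q , inj₂ (refl , q≤ℓp)) = 1≤p , 1≤q , inj₁ (≤-refl , q≤ℓp)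

  InRange-≤ : j ≤ j′ → InRange p q i j → InRange p q i j′
  InRange-≤ j≤j′ (1≤p , 1≤q , inj₁ earlier)       = 1≤p , 1≤q , inj₁ earlier
  InRange-≤ j≤j′ (1≤p , 1≤q , inj₂ (p≡i , q≤j)) = 1≤p , 1≤q , inj₂ (p≡i , ≤-trans q≤j j≤j′)

  InRange-first⁻ : InRange p q (suc i) 1 → InRange p q i (ℓ i) ⊎ (p ≡ suc i × q ≡ 1)
  InRange-first⁻ (1≤p , 1≤q , inj₁ (p<1+i , q≤ℓp)) with m<1+n⇒m<n∨m≡n p<1+i
  ... | inj₁ p<i  = inj₁ (1≤p , 1≤q , inj₁ (p<i , q≤ℓp))
  ... | inj₂ refl = inj₁ (1≤p , 1≤q , inj₂ (refl , q≤ℓp))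
  InRange-first⁻ (1≤p , 1≤q , inj₂ (p≡1+i , q≤1)) = inj₂ (p≡1+i , ≤-antisym q≤1 1≤q)

  InRange-ear : 1 ≤ j → j ≤ j′ → InRange (suc i) j (suc i) j′
  InRange-ear 1≤j j≤j′ = s≤s z≤n , 1≤j , inj₂ (refl , j≤j′)

  H-mono : (∀ {p q} → InRange p q i j → InRange p q i′ j′) → H i j ⊑ H i′ j′
  H-mono f = record
    { V⊆ = λ (p , q , r , v∈) → p , q , f r , v∈
    ; E⊆ = λ (p , q , r , uv∈) → p , q , f r , uv∈
    }

  ear⊆H-V : 1 ≤ j → j ≤ j′ → v ∈ P (suc i) j → Sub.V (H (suc i) j′) v
  ear⊆H-V 1≤j j≤j′ v∈ = _ , _ , InRange-ear 1≤j j≤j′ , v∈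

  ear⊆H-E : 1 ≤ j → j ≤ j′ → ListEdge (P (suc i) j) u v → Sub.E (H (suc i) j′) u v
  ear⊆H-E 1≤j j≤j′ uv∈ = _ , _ , InRange-ear 1≤j j≤j′ , uv∈

  first-ear⁻-V : Sub.V (H (suc i) 1) v → Sub.V (H i (ℓ i)) v ⊎ v ∈ P (suc i) 1
  first-ear⁻-V (p , q , r , v∈) with InRange-first⁻ r
  ... | inj₁ r′          = inj₁ (p , q , r′ , v∈)
  ... | inj₂ (refl , refl) = inj₂ v∈

  first-ear⁻-E : Sub.E (H (suc i) 1) u v → Sub.E (H i (ℓ i)) u v ⊎ ListEdge (P (suc i) 1) u v
  first-ear⁻-E (p , q , r , uv∈) with InRange-first⁻ r
  ... | inj₁ r′          = inj₁ (p , q , r′ , uv∈)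
  ... | inj₂ (refl , refl) = inj₂ uv∈

  H-edges-within : Sub.E (H i j) u v → Sub.V (H i j) u × Sub.V (H i j) v
  H-edges-within (p , q , r , uv∈) = (p , q , r , ListEdge⇒∈ˡ uv∈) , (p , q , r , ListEdge⇒∈ʳ uv∈)

  H-edge-sym : Sub.E (H i j) u v → Sub.E (H i j) v u
  H-edge-sym (p , q , r , uv∈) = p , q , r , Sum.swap uv∈

-- The last ear

-- The t of the statement is suc t here, so Hₚ = H t (ℓ t) is its H_{t-1,ℓ_{t-1}}.
module LastEar {n : ℕ} (G : Graph n) (ℓ : ℕ → ℕ) (P : ℕ → ℕ → List (Fin n)) (t : ℕ)
         (condA : Ear.CondA G ℓ P (suc t)) (condB : Ear.CondB G ℓ P (suc t))
         (condC : Ear.CondC G ℓ P (suc t) 2) (ℓ≥2 : 2 ≤ ℓ (suc t)) where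

  open Graph G renaming (sym to Adj-sym)
  open Ear G ℓ P using (H; TypeOne; InΓ)
  open EarIndexing G ℓ P
  open Zones G
  open Paths G
  open _⊑_

  Hₚ H₁ Hₜ : Sub n
  Hₚ = H t (ℓ t)
  H₁ = H (suc t) 1
  Hₜ = H (suc t) (ℓ (suc t))

  C : List (Fin n)
  C = P (suc t) 1

  private variable
    s u v w : Fin n

  Hₚ⊑H₁ : Hₚ ⊑ H₁
  Hₚ⊑H₁ = H-mono InRange-prev

  H₁⊑Hₜ : H₁ ⊑ Hₜ
  H₁⊑Hₜ = H-mono (InRange-≤ (≤-trans (s≤s z≤n) ℓ≥2))

  C⊆H₁ : v ∈ C → Sub.V H₁ v
  C⊆H₁ = ear⊆H-V ≤-refl ≤-refl

  C-edge⊆Hₜ : ListEdge C u v → Sub.E Hₜ u v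
  C-edge⊆Hₜ = E⊆ H₁⊑Hₜ ∘ ear⊆H-E ≤-refl ≤-refl

  ¬Zₚ-of-¬Z₁ : Sub.V Hₚ w → ¬ Z H₁ w → ¬ Z Hₚ w
  ¬Zₚ-of-¬Z₁ w∈Hₚ ¬Z₁w = ¬Z₁w ∘ Z-mono Hₚ⊑H₁ (λ _ k → k w∈Hₚ)

  type-one : TypeOne (suc t) → Adj a b → ¬ Sub.E Hₜ a b → Sub.V Hₚ a → b ∈ C → ¬ InΓ (suc t) b → ⊥
  type-one {a} {b} typeOne ab ab∉Hₜ a∈Hₚ b∈C b∉Γ
    with c , meetsOnce@(cycle , _ , c∈Hₚ , meetsOnlyAt) , shortest ← proj₁ condB typeOne =
    ¬¬-excluded-middle λ where
      (yes b∈Hₚ) → b∉Γ (typeOne , subst (λ x → OneMeetCycle G (Z Hₚ) Hₚ x C)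
                                         (sym (meetsOnlyAt b b∈C b∈Hₚ)) meetsOnce)
      (no b∉Hₚ)  → b-outside b∉Hₚ
    where
    open OnCycle cycle
    open WithoutHPaths H-edges-within condA cycle
    b-outside : ¬ Sub.V Hₚ b → ⊥
    b-outside b∉Hₚ with a ≟ c
    ... | yes refl = shortest-one-meet-cycle-chordless {H = Hₚ} shortest meetsOnce b∈C
                       (λ a≡b → b∉Hₚ (subst (Sub.V Hₚ) a≡b a∈Hₚ)) ab (ab∉Hₜ ∘ C-edge⊆Hₜ)
    ... | no a≢c   = one-meet-cycle-unattached meetsOnce a∈Hₚ
                       (¬Z-of-neighbour a∈Hₚ b∉Hₚ (cycle-avoids cycle b∈C) ab) ab b∈C
                       a≢c (λ b≡c → b∉Hₚ (subst (Sub.V Hₚ) (sym b≡c) c∈Hₚ))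

  module TypeTwo (typeTwo : ¬ TypeOne (suc t)) where

    cycle : IsCycleIn G (Z Hₚ) C
    cycle = proj₁ (proj₂ condB typeTwo)

    open OnCycle cycle
    open WithoutHPaths H-edges-within condA cycle
    open IsHEdge

    shortest : ∀ D → IsCycleIn G (Z Hₚ) D → cycLen C ≤ cycLen D
    shortest = proj₂ (proj₂ condB typeTwo)

    noOneMeet : ∀ c xs → ¬ OneMeetCycle G (Z Hₚ) Hₚ c xs
    noOneMeet c xs meetsOnce = typeTwo (c , xs , meetsOnce)

    cycle-disjoint : v ∈ C → ¬ Sub.V Hₚ v
    cycle-disjoint v∈C v∈Hₚ = IsHPath-restrict Hₚ⊑H₁ (Z-mono Hₚ⊑H₁ H₁⇒Hₚ) H₁⇒Hₚ (proj₁ condC) (condA _)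
      where
      H₁⇒Hₚ : Sub.V H₁ w → ¬ ¬ Sub.V Hₚ w
      H₁⇒Hₚ w∈H₁ w∉Hₚ with first-ear⁻-V w∈H₁
      ... | inj₁ w∈Hₚ = w∉Hₚ w∈Hₚ
      ... | inj₂ w∈C  = cycle-inside-or-disjoint noOneMeet v∈C v∈Hₚ w∈C w∉Hₚ

    branching-in-Hₚ : Deg≥3 H₁ s → Sub.V Hₚ s
    branching-in-Hₚ (x , y , z , x≢y , x≢z , y≢z , sx , sy , sz)
      with first-ear⁻-E sx | first-ear⁻-E sy | first-ear⁻-E sz
    ... | inj₁ sx | _       | _       = proj₁ (H-edges-within sx)
    ... | inj₂ _  | inj₁ sy | _       = proj₁ (H-edges-within sy)
    ... | inj₂ _  | inj₂ _  | inj₁ sz = proj₁ (H-edges-within sz)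
    ... | inj₂ sx | inj₂ sy | inj₂ sz = ⊥-elim ([ x≢y , [ x≢z , y≢z ]′ ]′ (cycle-degree≤2 sx sy sz))

    H₁-edge-at-Hₚ : Sub.V Hₚ s → Sub.E H₁ s w → Sub.E Hₚ s w
    H₁-edge-at-Hₚ s∈Hₚ sw with first-ear⁻-E sw
    ... | inj₁ sw∈Hₚ = sw∈Hₚ
    ... | inj₂ sw∈C  = ⊥-elim (cycle-disjoint (ListEdge⇒∈ˡ sw∈C) s∈Hₚ)

    Y₁⇒Yₚ : Y H₁ v → Sub.V Hₚ v × Y Hₚ v
    Y₁⇒Yₚ = Y-restrict {H = Hₚ} {H₁} H-edges-within H₁-edge-at-Hₚ branching-in-Hₚ

    ¬Z₁-on-C : v ∈ C → ¬ Z H₁ v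
    ¬Z₁-on-C v∈C = ¬Z-of-¬Y {H = H₁} (C⊆H₁ v∈C) (cycle-disjoint v∈C ∘ proj₁ ∘ Y₁⇒Yₚ)

    ¬Z₁-on-Hₚ : Sub.V Hₚ v → ¬ Z Hₚ v → ¬ Z H₁ v
    ¬Z₁-on-Hₚ v∈Hₚ ¬Zₚv = ¬Z-of-¬Y {H = H₁} (V⊆ Hₚ⊑H₁ v∈Hₚ) (¬Zₚv ∘ inj₁ ∘ proj₂ ∘ Y₁⇒Yₚ)

    ¬Zₚ-of-attachment : Sub.V Hₚ a → b ∈ C → Adj a b → ¬ Z Hₚ a
    ¬Zₚ-of-attachment a∈Hₚ b∈C = ¬Z-of-neighbour a∈Hₚ (cycle-disjoint b∈C) (cycle-avoids cycle b∈C)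

    attachment-isH₁Edge : Adj a b → ¬ Sub.E Hₜ a b → Sub.V Hₚ a → b ∈ C → IsHEdge (Z H₁) H₁ a b
    attachment-isH₁Edge ab ab∉Hₜ a∈Hₚ b∈C = record
      { start    = V⊆ Hₚ⊑H₁ a∈Hₚ
      ; end      = C⊆H₁ b∈C
      ; distinct = λ a≡b → cycle-disjoint b∈C (subst (Sub.V Hₚ) a≡b a∈Hₚ)
      ; adjacent = ab
      ; avoids   = ¬Z₁-on-Hₚ a∈Hₚ (¬Zₚ-of-attachment a∈Hₚ b∈C ab) , ¬Z₁-on-C b∈C
      ; notInH   = ab∉Hₜ ∘ E⊆ H₁⊑Hₜ
      }

    no-second-ear-edge : Adj a b → ¬ Sub.E Hₜ a b → Sub.V Hₚ a → ¬ Z Hₚ a → b ∈ C →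
                         IsHEdge (Z H₁) H₁ u v → Sub.E Hₜ u v → ⊥
    no-second-ear-edge ab ab∉Hₜ a∈Hₚ ¬Zₚa b∈C e uv∈Hₜ with first-ear⁻-V (start e) | first-ear⁻-V (end e)
    ... | inj₁ u∈Hₚ | inj₁ v∈Hₚ = condA _ (IsHEdge⇒IsHPath (record
      { start = u∈Hₚ ; end = v∈Hₚ ; distinct = distinct e ; adjacent = adjacent e
      ; avoids = ¬Zₚ-of-¬Z₁ u∈Hₚ (proj₁ (avoids e)) , ¬Zₚ-of-¬Z₁ v∈Hₚ (proj₂ (avoids e))
      ; notInH = notInH e ∘ E⊆ Hₚ⊑H₁ }))
    ... | inj₂ u∈C  | inj₂ v∈C  =
      shortest-cycle-chordless shortest u∈C v∈C (distinct e) (adjacent e) (notInH e ∘ ear⊆H-E ≤-refl ≤-refl)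
    ... | inj₁ u∈Hₚ | inj₂ v∈C  =
      attachment-unique noOneMeet cycle-disjoint a∈Hₚ ¬Zₚa ab b∈C u∈Hₚ (¬Zₚ-of-¬Z₁ u∈Hₚ (proj₁ (avoids e))) v∈C
        (Adj-sym (adjacent e)) (λ (u≡a , v≡b) → ab∉Hₜ (subst₂ (Sub.E Hₜ) u≡a v≡b uv∈Hₜ))
    ... | inj₂ u∈C  | inj₁ v∈Hₚ =
      attachment-unique noOneMeet cycle-disjoint a∈Hₚ ¬Zₚa ab b∈C v∈Hₚ (¬Zₚ-of-¬Z₁ v∈Hₚ (proj₂ (avoids e))) u∈C
        (adjacent e) (λ (v≡a , u≡b) → ab∉Hₜ (subst₂ (Sub.E Hₜ) v≡a u≡b (H-edge-sym uv∈Hₜ)))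

    type-two : Adj a b → ¬ Sub.E Hₜ a b → Sub.V Hₚ a → b ∈ C → ⊥
    type-two ab ab∉Hₜ a∈Hₚ b∈C
      with u , v , eq , uv ← shortest-HPath-is-edge (proj₁ condC) (proj₂ condC)
                               (IsHEdge⇒IsHPath (attachment-isH₁Edge ab ab∉Hₜ a∈Hₚ b∈C)) =
      no-second-ear-edge ab ab∉Hₜ a∈Hₚ (¬Zₚ-of-attachment a∈Hₚ b∈C ab) b∈C uv
        (ear⊆H-E (s≤s z≤n) ℓ≥2 (inj₁ (consec-subst (sym eq) here)))

lemma3p8 : ∀ {n} (G : Graph n) → Girth≥5 G →
    (t : ℕ) (ℓ : ℕ → ℕ) (P : ℕ → ℕ → List (Fin n)) →
    Ear.IsCoarseEarDecomposition G ℓ P t → 2 ≤ t → 2 ≤ ℓ t →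
    (a b : Fin n) → Graph.Adj G a b →
    ¬ Sub.E (Ear.H G ℓ P t (ℓ t)) a b →
    Sub.V (Ear.Hprev G ℓ P t) a →
    b ∈ P t 1 →
    ¬ Ear.InΓ G ℓ P t b →
    ⊥
lemma3p8 G _ zero    ℓ P _ () _ _ _ _ _ _ _ _
lemma3p8 G _ (suc t) ℓ P (_ , condA , condB , condC) _ ℓ≥2 a b ab ab∉Hₜ a∈Hₚ b∈C b∉Γ =
  ¬¬-excluded-middle λ where
    (yes typeOne) → type-one typeOne ab ab∉Hₜ a∈Hₚ b∈C b∉Γ
    (no typeTwo)  → TypeTwo.type-two typeTwo ab ab∉Hₜ a∈Hₚ b∈C
  where
  open LastEar G ℓ P t (condA (suc t) (s≤s z≤n) ≤-refl) (condB (suc t) (s≤s z≤n) ≤-refl)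
                       (condC (suc t) 2 (s≤s z≤n) ≤-refl (s≤s (s≤s z≤n)) ℓ≥2) ℓ≥2
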